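{- For any term $t$, $(\bar t)\!\downarrow\;=\;\overline{t\!\downarrow}$, i.e. the CaseCase-normal form of the case-completion of $t$ equals the case-completion of the CaseCase-normal form of $t$.
   Context: The lambda calculus with constructors ($\lambda_C$). Fix constructors $\{c_1,\dots,c_n\}$ ($n\ge1$). Terms: $t,u::=x\mid tu\mid\lambda x.t\mid c\mid\{\theta\}\cdot t$, case-bindings $\theta=\{d_1\mapsto u_1;\dots;d_k\mapsto u_k\}$ ($k\ge0$, pairwise distinct constructors), $\mathrm{dom}(\theta)=\{d_1,\dots,d_k\}$; terms up to $\alpha$-conversion. $\theta\circ\{d_j\mapsto t_j\}_j=\{d_j\mapsto\{\theta\}\cdot t_j\}_j$. $\to_{cc}$ is the contextual closure (also inside case-bindings) of the rule (CaseCase) $\{\theta\}\cdot\{\phi\}\cdot t\to\{\theta\circ\phi\}\cdot t$. This rewriting system is confluent and strongly normalising (known facts), so every term $t$ has a unique $\to_{cc}$-normal form, denoted $t\!\downarrow$. Case-completion: $\bar x=x$, $\bar c=c$, $\overline{\lambda x.t}=\lambda x.\bar t$, $\overline{tu}=\bar t\,\bar u$, $\overline{\{\theta\}\cdot t}=\{\bar\theta\}\cdot\bar t$, where $\bar\theta=\{c_i\mapsto u'_i\mid1\le i\le n\}$ with $u'_i=\bar u_i$ if $(c_i\mapsto u_i)\in\theta$ and $u'_i=\{\}\cdot c_1$ (empty case-binding applied to $c_1$) if $c_i\notin\mathrm{dom}(\theta)$. -}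

module Defs where

open import Data.Nat using (ℕ; suc)
open import Data.Fin using (Fin; zero)
open import Data.Maybe using (Maybe; just; nothing)
import Data.Maybe as Maybe
open import Data.Vec using (Vec; []; _∷_; lookup; _[_]≔_; replicate)
import Data.Vec as Vec
open import Data.Product using (∃)
open import Relation.Nullary using (¬_)
open import Relation.Binary.PropositionalEquality using (_≡_)
open import Relation.Binary.Construct.Closure.ReflexiveTransitive using (Star)

-- Terms of the lambda calculus with constructors, over the constructor set
-- Fin n = {c_1,...,c_n} (c_1 = zero).  Variables are de Bruijn indices,
-- so syntactic equality is equality up to alpha-conversion.
-- A case-binding is a finite partial map from constructors to terms,
-- represented as a vector indexed by constructors: entry i is
-- just u  iff  (c_i ↦ u) ∈ θ, and nothing iff c_i ∉ dom(θ).
data Term (n : ℕ) : Set where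
  var  : ℕ → Term n
  app  : Term n → Term n → Term n
  lam  : Term n → Term n
  con  : Fin n → Term n
  case : Vec (Maybe (Term n)) n → Term n → Term n

CaseBinding : ℕ → Set
CaseBinding n = Vec (Maybe (Term n)) n

_∘cb_ : ∀ {n} → CaseBinding n → CaseBinding n → CaseBinding n
θ ∘cb φ = Vec.map (Maybe.map (case θ)) φ

data _⟶cc_ {n : ℕ} : Term n → Term n → Set where
  caseCase : ∀ θ φ t → case θ (case φ t) ⟶cc case (θ ∘cb φ) t
  appˡ     : ∀ {t t'} u → t ⟶cc t' → app t u ⟶cc app t' u
  appʳ     : ∀ t {u u'} → u ⟶cc u' → app t u ⟶cc app t u'
  lamᶜ     : ∀ {t t'} → t ⟶cc t' → lam t ⟶cc lam t'
  caseBody : ∀ θ {t t'} → t ⟶cc t' → case θ t ⟶cc case θ t'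
  caseBind : ∀ θ i {u u'} t → lookup θ i ≡ just u → u ⟶cc u' →
             case θ t ⟶cc case (θ [ i ]≔ just u') t

_⟶cc*_ : ∀ {n} → Term n → Term n → Set
_⟶cc*_ = Star _⟶cc_

NormalCC : ∀ {n} → Term n → Set
NormalCC t = ¬ ∃ (λ t' → t ⟶cc t')

IsNFcc : ∀ {n} → Term n → Term n → Set
IsNFcc t u = (t ⟶cc* u) Data.Product.× NormalCC u

-- Case-completion (constructor set Fin (suc m), so n ≥ 1 and c_1 = zero)
mutual
  complete : ∀ {m} → Term (suc m) → Term (suc m)
  complete (var x)    = var x
  complete (app t u)  = app (complete t) (complete u)
  complete (lam t)    = lam (complete t)
  complete (con c)    = con c
  complete (case θ t) = case (completeCB θ) (complete t)

  completeCB : ∀ {m k} → Vec (Maybe (Term (suc m))) k → Vec (Maybe (Term (suc m))) k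
  completeCB []             = []
  completeCB (just u ∷ θ)   = just (complete u) ∷ completeCB θ
  completeCB (nothing ∷ θ)  = just (case (replicate _ nothing) (con zero)) ∷ completeCB θ

-- Case-completion maps each CaseCase step to a CaseCase step followed by
-- reductions inside the case-binding: completing θ ∘ φ differs from composing
-- the completions only on the constructors missing from φ, where {θ̄}·{}·c₁
-- reduces to {}·c₁ in one step.  Hence reductions are simulated.  Normality is
-- preserved because normal forms are exactly the terms with no case directly
-- under a case; completion keeps the head symbol of every case body, and the
-- terms {}·c₁ it inserts are normal.
module Submission where

open import Defs
open import Data.Nat using (ℕ; suc)
open import Data.Fin using (Fin; zero; suc)
open import Data.Maybe using (Maybe; just; nothing)
import Data.Maybe as Maybe
open import Data.Maybe.Relation.Binary.Pointwise as Maybeᵖ using (just; nothing)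
open import Data.Vec using (Vec; []; _∷_; lookup; _[_]≔_; replicate)
import Data.Vec as Vec
open import Data.Vec.Properties using (map-replicate)
open import Data.Vec.Relation.Binary.Pointwise.Inductive as Vecᵖ using (Pointwise; []; _∷_)
open import Data.Product using (_,_)
open import Data.Unit using (⊤; tt)
open import Data.Empty using (⊥)
open import Relation.Binary.PropositionalEquality using (_≡_; refl; subst)
open import Relation.Binary.Construct.Closure.ReflexiveTransitive using (ε; _◅_; _◅◅_; gmap)

module _ {m : ℕ} where

  private
    T = Term (suc m)
    Bindings = Vec (Maybe T)

  _⟶cb*_ : ∀ {k} → Bindings k → Bindings k → Set
  _⟶cb*_ = Pointwise (Maybeᵖ.Pointwise _⟶cc*_)

  ⟶cb*-refl : ∀ {k} (θ : Bindings k) → θ ⟶cb* θ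
  ⟶cb*-refl θ = Vecᵖ.refl (Maybeᵖ.refl ε)

  SingleBindingStep : ∀ {k} → (Bindings k → T) → Set
  SingleBindingStep {k} C =
    ∀ θ (i : Fin k) {u u'} → lookup θ i ≡ just u → u ⟶cc u' → C θ ⟶cc C (θ [ i ]≔ just u')

  lift-⟶cb* : ∀ {k} (C : Bindings k → T) → SingleBindingStep C →
              ∀ {θ θ'} → θ ⟶cb* θ' → C θ ⟶cc* C θ'
  lift-⟶cb* C step [] = ε
  lift-⟶cb* C step (nothing ∷ rest) =
    lift-⟶cb* (λ θ → C (nothing ∷ θ)) (λ θ i → step (nothing ∷ θ) (suc i)) rest
  lift-⟶cb* C step {just _ ∷ θ} (just {y = b} head ∷ rest) =
    first head ◅◅ lift-⟶cb* (λ θ → C (just b ∷ θ)) (λ θ i → step (just b ∷ θ) (suc i)) rest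
    where
    first : ∀ {a a'} → a ⟶cc* a' → C (just a ∷ θ) ⟶cc* C (just a' ∷ θ)
    first ε          = ε
    first (s ◅ rest) = step _ zero refl s ◅ first rest

  case-⟶cb* : ∀ {θ θ'} (t : T) → θ ⟶cb* θ' → case θ t ⟶cc* case θ' t
  case-⟶cb* t = lift-⟶cb* (λ θ → case θ t) (λ θ i → caseBind θ i t)

  fallback : T
  fallback = case (replicate _ nothing) (con zero)

  ∘cb-empty : ∀ (θ : CaseBinding (suc m)) → θ ∘cb replicate _ nothing ≡ replicate _ nothing
  ∘cb-empty θ = map-replicate (Maybe.map (case θ)) nothing (suc m)

  case-fallback : ∀ (θ : CaseBinding (suc m)) → case θ fallback ⟶cc fallback
  case-fallback θ = subst (λ ψ → case θ fallback ⟶cc case ψ (con zero))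
                          (∘cb-empty θ) (caseCase θ _ (con zero))

  ∘cb-completeCB : ∀ {k} (θ : CaseBinding (suc m)) (φ : Bindings k) →
                   Vec.map (Maybe.map (case (completeCB θ))) (completeCB φ)
                     ⟶cb* completeCB (Vec.map (Maybe.map (case θ)) φ)
  ∘cb-completeCB θ []            = []
  ∘cb-completeCB θ (just _ ∷ φ)  = just ε ∷ ∘cb-completeCB θ φ
  ∘cb-completeCB θ (nothing ∷ φ) = just (case-fallback (completeCB θ) ◅ ε) ∷ ∘cb-completeCB θ φ

  completeCB-[]≔ : ∀ {k} (θ : Bindings k) i {u u'} → lookup θ i ≡ just u →
                   complete u ⟶cc* complete u' → completeCB θ ⟶cb* completeCB (θ [ i ]≔ just u')
  completeCB-[]≔ (just _ ∷ θ)  zero    refl s = just s ∷ ⟶cb*-refl (completeCB θ)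
  completeCB-[]≔ (just _ ∷ θ)  (suc i) eq   s = just ε ∷ completeCB-[]≔ θ i eq s
  completeCB-[]≔ (nothing ∷ θ) (suc i) eq   s = just ε ∷ completeCB-[]≔ θ i eq s

  complete-⟶cc : ∀ {t t' : T} → t ⟶cc t' → complete t ⟶cc* complete t'
  complete-⟶cc (caseCase θ φ t)      = caseCase _ _ _ ◅ case-⟶cb* (complete t) (∘cb-completeCB θ φ)
  complete-⟶cc (appˡ u s)            = gmap (λ z → app z (complete u)) (appˡ _) (complete-⟶cc s)
  complete-⟶cc (appʳ t s)            = gmap (app (complete t)) (appʳ _) (complete-⟶cc s)
  complete-⟶cc (lamᶜ s)              = gmap lam lamᶜ (complete-⟶cc s)
  complete-⟶cc (caseBody θ s)        = gmap (case (completeCB θ)) (caseBody _) (complete-⟶cc s)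
  complete-⟶cc (caseBind θ i t eq s) = case-⟶cb* (complete t) (completeCB-[]≔ θ i eq (complete-⟶cc s))

  complete-⟶cc* : ∀ {t t' : T} → t ⟶cc* t' → complete t ⟶cc* complete t'
  complete-⟶cc* ε        = ε
  complete-⟶cc* (s ◅ ss) = complete-⟶cc s ◅◅ complete-⟶cc* ss

  NotCase : T → Set
  NotCase (case _ _) = ⊥
  NotCase _          = ⊤

  mutual
    data Nf : T → Set where
      var  : ∀ x → Nf (var x)
      con  : ∀ c → Nf (con c)
      app  : ∀ {t u} → Nf t → Nf u → Nf (app t u)
      lam  : ∀ {t} → Nf t → Nf (lam t)
      case : ∀ {θ t} → NfCB θ → Nf t → NotCase t → Nf (case θ t)

    data NfCB : ∀ {k} → Bindings k → Set where
      []      : NfCB []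
      nothing : ∀ {k} {θ : Bindings k} → NfCB θ → NfCB (nothing ∷ θ)
      just    : ∀ {k u} {θ : Bindings k} → Nf u → NfCB θ → NfCB (just u ∷ θ)

  lookup-NfCB : ∀ {k} {θ : Bindings k} i {u} → NfCB θ → lookup θ i ≡ just u → Nf u
  lookup-NfCB zero    (just nf _)  refl = nf
  lookup-NfCB (suc i) (nothing nf) eq   = lookup-NfCB i nf eq
  lookup-NfCB (suc i) (just _ nf)  eq   = lookup-NfCB i nf eq

  Nf⇒normal : ∀ {t t' : T} → Nf t → t ⟶cc t' → ⊥
  Nf⇒normal (case _ _ ()) (caseCase θ φ t)
  Nf⇒normal (app nf _)    (appˡ u s)            = Nf⇒normal nf s
  Nf⇒normal (app _ nf)    (appʳ t s)            = Nf⇒normal nf s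
  Nf⇒normal (lam nf)      (lamᶜ s)              = Nf⇒normal nf s
  Nf⇒normal (case _ nf _) (caseBody θ s)        = Nf⇒normal nf s
  Nf⇒normal (case nf _ _) (caseBind θ i t eq s) = Nf⇒normal (lookup-NfCB i nf eq) s

  normal-inside : ∀ (C : T → T) → (∀ {t t'} → t ⟶cc t' → C t ⟶cc C t') →
                  ∀ {t} → NormalCC (C t) → NormalCC t
  normal-inside C step normal (_ , s) = normal (_ , step s)

  normal-body-NotCase : ∀ (θ : CaseBinding (suc m)) (t : T) → NormalCC (case θ t) → NotCase t
  normal-body-NotCase θ (var _)    _      = tt
  normal-body-NotCase θ (app _ _)  _      = tt
  normal-body-NotCase θ (lam _)    _      = tt
  normal-body-NotCase θ (con _)    _      = tt
  normal-body-NotCase θ (case φ t) normal = normal (_ , caseCase θ φ t)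

  mutual
    normal⇒Nf : (t : T) → NormalCC t → Nf t
    normal⇒Nf (var x)    _      = var x
    normal⇒Nf (con c)    _      = con c
    normal⇒Nf (app t u)  normal = app (normal⇒Nf t (normal-inside (λ z → app z u) (appˡ u) normal))
                                      (normal⇒Nf u (normal-inside (app t) (appʳ t) normal))
    normal⇒Nf (lam t)    normal = lam (normal⇒Nf t (normal-inside lam lamᶜ normal))
    normal⇒Nf (case θ t) normal =
      case (normal⇒NfCB θ (λ i eq s → normal (_ , caseBind θ i t eq s)))
           (normal⇒Nf t (normal-inside (case θ) (caseBody θ) normal))
           (normal-body-NotCase θ t normal)

    normal⇒NfCB : ∀ {k} (θ : Bindings k) →
                  (∀ i {u u'} → lookup θ i ≡ just u → u ⟶cc u' → ⊥) → NfCB θ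
    normal⇒NfCB []            _      = []
    normal⇒NfCB (nothing ∷ θ) normal = nothing (normal⇒NfCB θ (λ i → normal (suc i)))
    normal⇒NfCB (just u ∷ θ)  normal =
      just (normal⇒Nf u (λ (_ , s) → normal zero refl s)) (normal⇒NfCB θ (λ i → normal (suc i)))

  NfCB-empty : ∀ k → NfCB (replicate k nothing)
  NfCB-empty ℕ.zero  = []
  NfCB-empty (suc k) = nothing (NfCB-empty k)

  complete-NotCase : ∀ (t : T) → NotCase t → NotCase (complete t)
  complete-NotCase (var _)   _ = tt
  complete-NotCase (app _ _) _ = tt
  complete-NotCase (lam _)   _ = tt
  complete-NotCase (con _)   _ = tt

  mutual
    complete-Nf : ∀ {t : T} → Nf t → Nf (complete t)
    complete-Nf (var x)      = var x
    complete-Nf (con c)      = con c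
    complete-Nf (app nf nf') = app (complete-Nf nf) (complete-Nf nf')
    complete-Nf (lam nf)     = lam (complete-Nf nf)
    complete-Nf (case {t = t} nf nf' ¬case) =
      case (completeCB-NfCB nf) (complete-Nf nf') (complete-NotCase t ¬case)

    completeCB-NfCB : ∀ {k} {θ : Bindings k} → NfCB θ → NfCB (completeCB θ)
    completeCB-NfCB []           = []
    completeCB-NfCB (nothing nf) = just (case (NfCB-empty _) (con zero) tt) (completeCB-NfCB nf)
    completeCB-NfCB (just u nf)  = just (complete-Nf u) (completeCB-NfCB nf)

  complete-normal : ∀ (u : T) → NormalCC u → NormalCC (complete u)
  complete-normal u normal (_ , s) = Nf⇒normal (complete-Nf (normal⇒Nf u normal)) s

lemma6 : ∀ (m : ℕ) (t u : Term (suc m)) → IsNFcc t u → IsNFcc (complete t) (complete u)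
lemma6 m t u (t⟶*u , u-normal) = complete-⟶cc* t⟶*u , complete-normal u u-normal
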